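{- $\vec\chi(Forb_{ind}(\overleftrightarrow{K_2}, \overrightarrow{C_3}, \overrightarrow{K_2}+K_1))=2$, i.e. the maximum dichromatic number of a digraph with no induced digon, no induced directed triangle and no induced copy of $\overrightarrow{K_2}+K_1$ is $2$.
   Context: Digraphs have no loops and no parallel arcs, but both $xy$ and $yx$ may be arcs. The dichromatic number $\vec\chi(D)$ is the minimum number of colors in a vertex coloring of $D$ in which no color class induces a directed cycle; for a class $\mathcal C$, $\vec\chi(\mathcal C)=\sup_{D\in\mathcal C}\vec\chi(D)$. $Forb_{ind}(\mathcal F)$ is the class of digraphs containing no member of $\mathcal F$ as an induced subdigraph. $\overleftrightarrow{K_2}$ is the digon (two vertices with arcs in both directions), $\overrightarrow{C_3}$ the directed cycle of length $3$, and $\overrightarrow{K_2}+K_1$ the disjoint union of one arc and an isolated vertex. -}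

module Defs where

open import Data.Nat using (ℕ; zero; suc)
open import Data.Fin using (Fin; zero; suc; inject₁; fromℕ)
open import Data.Bool using (Bool; true; false)
open import Data.Product using (Σ; ∃; _×_; _,_)
open import Relation.Binary.PropositionalEquality using (_≡_)
open import Relation.Nullary using (¬_)
open import Function.Definitions using (Injective)

-- A finite digraph on vertex set Fin n: an arc relation (as a Bool matrix)
-- with no loops. Parallel arcs cannot occur; both xy and yx may be arcs.
record Digraph : Set where
  field
    n        : ℕ
    arc      : Fin n → Fin n → Bool
    loopless : ∀ x → arc x x ≡ false
open Digraph public

_⊑ind_ : Digraph → Digraph → Set
H ⊑ind D = Σ (Fin (n H) → Fin (n D)) λ f →
  Injective _≡_ _≡_ f × (∀ i j → arc D (f i) (f j) ≡ arc H i j)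

digonArc : Fin 2 → Fin 2 → Bool
digonArc zero (suc zero) = true
digonArc (suc zero) zero = true
digonArc _ _ = false

digon : Digraph
digon = record { n = 2 ; arc = digonArc ; loopless = λ { zero → _≡_.refl ; (suc zero) → _≡_.refl } }

c3Arc : Fin 3 → Fin 3 → Bool
c3Arc zero (suc zero) = true
c3Arc (suc zero) (suc (suc zero)) = true
c3Arc (suc (suc zero)) zero = true
c3Arc _ _ = false

C3 : Digraph
C3 = record { n = 3 ; arc = c3Arc
            ; loopless = λ { zero → _≡_.refl ; (suc zero) → _≡_.refl ; (suc (suc zero)) → _≡_.refl } }

k2k1Arc : Fin 3 → Fin 3 → Bool
k2k1Arc zero (suc zero) = true
k2k1Arc _ _ = false

K2+K1 : Digraph
K2+K1 = record { n = 3 ; arc = k2k1Arc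
               ; loopless = λ { zero → _≡_.refl ; (suc zero) → _≡_.refl ; (suc (suc zero)) → _≡_.refl } }

InForb : Digraph → Set
InForb D = ¬ (digon ⊑ind D) × ¬ (C3 ⊑ind D) × ¬ (K2+K1 ⊑ind D)

-- A directed cycle of length m+2 ≥ 2 in D: distinct vertices
-- c 0, …, c (m+1) with arcs c i → c (i+1) and c (m+1) → c 0.
record DirectedCycle (D : Digraph) : Set where
  field
    m      : ℕ
    vtx    : Fin (suc (suc m)) → Fin (n D)
    inj    : Injective _≡_ _≡_ vtx
    step   : ∀ (i : Fin (suc m)) → arc D (vtx (inject₁ i)) (vtx (suc i)) ≡ true
    close  : arc D (vtx (fromℕ (suc m))) (vtx zero) ≡ true
open DirectedCycle public

IsDicolouring : (D : Digraph) (k : ℕ) → (Fin (n D) → Fin k) → Set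
IsDicolouring D k col =
  ∀ (C : DirectedCycle D) → ¬ (∀ i → col (vtx C i) ≡ col (vtx C zero))

Dicolourable : Digraph → ℕ → Set
Dicolourable D k = Σ (Fin (n D) → Fin k) (IsDicolouring D k)

-- Forbidding an induced K₂+K₁ makes non-adjacency transitive, so D is an orientation
-- of a complete multipartite graph without directed triangles.  In such a digraph a
-- vertex adjacent to every vertex of a directed cycle C either dominates C or is
-- dominated by it, and an invariant carried along arcs shows that no vertex reachable
-- from C dominates it; dually no vertex reaching C is dominated by it.  Hence no vertex
-- strongly connected to C is adjacent to all of C.  Colour a vertex 0 when it lies in
-- the same part as a fixed representative of its strong component and 1 otherwise:
-- a cycle of colour 0 would lie inside one part, a cycle of colour 1 would be joined
-- completely to the representative.  The directed 4-cycle needs two colours.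

module Submission where

open import Defs
open import Data.Bool using (Bool; true; false)
import Data.Bool.Properties as Bool
open import Data.Empty using (⊥)
open import Data.Fin using (Fin; zero; suc; inject₁; fromℕ; _<_; _≟_)
open import Data.Fin.Induction using (<-weakInduction; >-weakInduction)
open import Data.Fin.Patterns using (0F; 1F; 2F; 3F)
open import Data.Fin.Properties using (all?; any?; <-cmp; injective⇒≤; suc-injective)
open import Data.Nat as ℕ using (ℕ; zero; suc; z≤n; s≤s)
open import Data.Nat.Properties using (<⇒≤)
open import Data.Product using (Σ; ∃; _×_; _,_; proj₁; proj₂)
open import Data.Sum as Sum using (_⊎_; inj₁; inj₂; [_,_]; swap)
open import Data.Vec using ([]; _∷_; lookup)
open import Function using (id; flip; _∘_)
open import Function.Definitions using (Injective)
open import Level using (Level; _⊔_; 0ℓ)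
open import Relation.Binary using (Rel; Decidable; Asymmetric; Transitive; tri<; tri≈; tri>)
open import Relation.Binary.Construct.Closure.ReflexiveTransitive using (Star; ε; _◅_; _◅◅_; reverse)
open import Relation.Binary.PropositionalEquality using (_≡_; _≢_; refl; sym; cong; subst; module ≡-Reasoning)
open import Relation.Nullary using (¬_; Dec; yes; no; contradiction)
open import Relation.Nullary.Decidable using (map′; from-yes; ¬?; _×-dec_; _⊎-dec_; _→-dec_)
open import Relation.Unary as U using (Pred; _≐_)

private variable
  a ℓ : Level
  k : ℕ
  V : Set a

Least : Pred (Fin k) ℓ → Pred (Fin k) ℓ
Least P x = P x × ∀ {y} → y < x → ¬ P y

least : {P : Pred (Fin k) ℓ} → U.Decidable P → ∃ P → ∃ (Least P)
least P? (zero , P₀) = zero , P₀ , λ ()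
least P? (suc y , Py) with P? zero
... | yes P₀ = zero , P₀ , λ ()
... | no ¬P₀ with least (P? ∘ suc) (y , Py)
... | x , Px , below = suc x , Px , λ { {zero} _ → ¬P₀ ; {suc z} (s≤s z<x) → below z<x }

least-unique : {P Q : Pred (Fin k) ℓ} → P ≐ Q → ∀ {x y} → Least P x → Least Q y → x ≡ y
least-unique (P⊆Q , Q⊆P) {x} {y} (Px , below-x) (Qy , below-y) with <-cmp x y
... | tri< x<y _ _ = contradiction (P⊆Q Px) (below-y x<y)
... | tri≈ _ x≡y _ = x≡y
... | tri> _ _ y<x = contradiction (Q⊆P Qy) (below-x y<x)

module _ {R : Rel (Fin k) ℓ} where

  length : ∀ {x y} → Star R x y → ℕ
  length ε       = 0
  length (_ ◅ p) = suc (length p)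

  vertex : ∀ {x y} (p : Star R x y) → Fin (suc (length p)) → Fin k
  vertex {x} _   zero    = x
  vertex (_ ◅ p) (suc i) = vertex p i

  Simple : ∀ {x y} → Star R x y → Set
  Simple p = Injective _≡_ _≡_ (vertex p)

  suffix : ∀ {x y} (p : Star R x y) (i : Fin (suc (length p))) → Star R (vertex p i) y
  suffix p       zero    = p
  suffix (_ ◅ p) (suc i) = suffix p i

  suffix-simple : ∀ {x y} (p : Star R x y) i → Simple p → Simple (suffix p i)
  suffix-simple p       zero    simple = simple
  suffix-simple (_ ◅ p) (suc i) simple = suffix-simple p i (suc-injective ∘ simple)

  ◅-simple : ∀ {x y z} (a : R x y) {p : Star R y z} →
             (∀ i → vertex p i ≢ x) → Simple p → Simple (a ◅ p)
  ◅-simple a x∉p simple {zero}  {zero}  _     = refl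
  ◅-simple a x∉p simple {zero}  {suc j} x≡pⱼ  = contradiction (sym x≡pⱼ) (x∉p j)
  ◅-simple a x∉p simple {suc i} {zero}  pᵢ≡x  = contradiction pᵢ≡x (x∉p i)
  ◅-simple a x∉p simple {suc i} {suc j} pᵢ≡pⱼ = cong suc (simple pᵢ≡pⱼ)

  simplify : ∀ {x y} → Star R x y → Σ (Star R x y) Simple
  simplify ε = ε , λ { {zero} {zero} _ → refl }
  simplify {x} {y} (a ◅ p) with simplify p
  ... | q , q-simple with any? (λ i → vertex q i ≟ x)
  ... | yes (i , qᵢ≡x) = subst (λ z → Σ (Star R z y) Simple) qᵢ≡x (suffix q i , suffix-simple q i q-simple)
  ... | no x∉q         = a ◅ q , ◅-simple a (λ i qᵢ≡x → x∉q (i , qᵢ≡x)) q-simple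

  simple-length : ∀ {x y} (p : Star R x y) → Simple p → length p ℕ.< k
  simple-length p = injective⇒≤

  StarWithin : ℕ → Rel (Fin k) ℓ
  StarWithin d x y = ∃ λ (p : Star R x y) → length p ℕ.≤ d

  starWithin? : Decidable R → ∀ d → Decidable (StarWithin d)
  starWithin? R? zero    x y = map′ (λ { refl → ε , z≤n }) (λ { (ε , _) → refl }) (x ≟ y)
  starWithin? R? (suc d) x y =
    map′ (λ { (inj₁ refl) → ε , z≤n ; (inj₂ (_ , a , p , l)) → a ◅ p , s≤s l })
         (λ { (ε , _) → inj₁ refl ; (a ◅ p , s≤s l) → inj₂ (_ , a , p , l) })
         (x ≟ y ⊎-dec any? λ z → R? x z ×-dec starWithin? R? d z y)

  star? : Decidable R → Decidable (Star R)
  star? R? x y = map′ proj₁ shorten (starWithin? R? k x y)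
    where
    shorten : Star R x y → StarWithin k x y
    shorten p with simplify p
    ... | q , q-simple = q , <⇒≤ (simple-length q q-simple)

Adjacent : Rel V ℓ → Rel V ℓ
Adjacent R x y = R x y ⊎ R y x

NonAdjacent : Rel V ℓ → Rel V ℓ
NonAdjacent R x y = ¬ Adjacent R x y

module _ {V : Set a} (R : Rel V ℓ) {I : Set} (c : I → V) where

  Complete : V → Set ℓ
  Complete v = ∀ i → Adjacent R v (c i)

  Dominating : V → Set ℓ
  Dominating v = ∀ i → R v (c i)

  Dominated : V → Set ℓ
  Dominated v = ∀ i → R (c i) v

  Homogeneous : Set (a ⊔ ℓ)
  Homogeneous = ∀ {v} → Complete v → Dominating v ⊎ Dominated v

record IsC3FreeMultipartiteTournament {V : Set a} (_⇒_ : Rel V ℓ) : Set (a ⊔ ℓ) where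
  field
    _⇒?_        : Decidable _⇒_
    asym        : Asymmetric _⇒_
    no-triangle : ∀ {x y z} → x ⇒ y → y ⇒ z → ¬ z ⇒ x
    ≁-trans     : Transitive (NonAdjacent _⇒_)

  adjacent? : Decidable (Adjacent _⇒_)
  adjacent? x y = x ⇒? y ⊎-dec y ⇒? x

  irrefl : ∀ {x} → ¬ x ⇒ x
  irrefl x⇒x = asym x⇒x x⇒x

  orient : ∀ {x y} → Adjacent _⇒_ x y → ¬ y ⇒ x → x ⇒ y
  orient x~y ¬y⇒x = [ id , flip contradiction ¬y⇒x ] x~y

reverse-C3Free : {_⇒_ : Rel V ℓ} →
                 IsC3FreeMultipartiteTournament _⇒_ → IsC3FreeMultipartiteTournament (flip _⇒_)
reverse-C3Free T = record
  { _⇒?_        = flip _⇒?_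
  ; asym        = asym
  ; no-triangle = λ x⇐y y⇐z z⇐x → no-triangle z⇐x y⇐z x⇐y
  ; ≁-trans     = λ x≁y y≁z → ≁-trans (x≁y ∘ swap) (y≁z ∘ swap) ∘ swap
  }
  where open IsC3FreeMultipartiteTournament T

module _ {R : Rel V ℓ} {m} {c : Fin (suc (suc m)) → V}
         (step : ∀ i → R (c (inject₁ i)) (c (suc i))) (close : R (c (fromℕ (suc m))) (c zero)) where

  cycle-from-start : ∀ i → Star R (c zero) (c i)
  cycle-from-start = <-weakInduction _ ε λ i p → p ◅◅ step i ◅ ε

  cycle-to-start : ∀ i → Star R (c i) (c zero)
  cycle-to-start = >-weakInduction _ (close ◅ ε) λ i p → step i ◅ p

module _ {V : Set a} {_⇒_ : Rel V ℓ} (T : IsC3FreeMultipartiteTournament _⇒_) where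
  open IsC3FreeMultipartiteTournament T

  cycle-homogeneous : ∀ {m} {c : Fin (suc (suc m)) → V} →
                      (∀ i → c (inject₁ i) ⇒ c (suc i)) → c (fromℕ (suc m)) ⇒ c zero →
                      Homogeneous _⇒_ c
  cycle-homogeneous {m} {c} step close {v} complete = Sum.map all-out all-in (complete zero)
    where
    all-out : v ⇒ c zero → Dominating _⇒_ c v
    all-out v⇒c₀ = <-weakInduction (λ i → v ⇒ c i) v⇒c₀ λ i v⇒cᵢ →
      orient (complete (suc i)) (no-triangle v⇒cᵢ (step i))
    all-in : c zero ⇒ v → Dominated _⇒_ c v
    all-in c₀⇒v = >-weakInduction (λ i → c i ⇒ v)
      (orient (swap (complete _)) λ v⇒cₗ → no-triangle v⇒cₗ close c₀⇒v)
      λ i cᵢ₊₁⇒v → orient (swap (complete (inject₁ i))) λ v⇒cᵢ → no-triangle v⇒cᵢ (step i) cᵢ₊₁⇒v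

  module _ {I : Set} {c : I → V} (homogeneous : Homogeneous _⇒_ c)
           {i₀ i₁ : I} (c₀⇒c₁ : c i₀ ⇒ c i₁) where

    adjacent-to-some : ∀ v → ∃ λ i → Adjacent _⇒_ v (c i)
    adjacent-to-some v with adjacent? v (c i₀) | adjacent? v (c i₁)
    ... | yes v~c₀ | _        = i₀ , v~c₀
    ... | no _     | yes v~c₁ = i₁ , v~c₁
    ... | no v≁c₀  | no v≁c₁  = contradiction (inj₁ c₀⇒c₁) (≁-trans (v≁c₀ ∘ swap) v≁c₁)

    non-neighbour-complete : ∀ {v w} → Complete _⇒_ c v → NonAdjacent _⇒_ v w → Complete _⇒_ c w
    non-neighbour-complete v-complete v≁w i with adjacent? _ (c i)
    ... | yes w~cᵢ = w~cᵢ
    ... | no w≁cᵢ  = contradiction (v-complete i) (≁-trans v≁w w≁cᵢ)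

    dominated-if-not-dominating : ∀ {w} → Complete _⇒_ c w → ¬ Dominating _⇒_ c w → Dominated _⇒_ c w
    dominated-if-not-dominating w-complete w-not-dom =
      [ flip contradiction w-not-dom , id ] (homogeneous w-complete)

    Downstream : V → Set (a ⊔ ℓ)
    Downstream q = (∀ {v} → Dominating _⇒_ c v → Adjacent _⇒_ v q → v ⇒ q) × ¬ Dominating _⇒_ c q

    downstream-step : ∀ {q q′} → Downstream q → q ⇒ q′ → Downstream q′
    downstream-step {q} {q′} (absorbs , q-not-dom) q⇒q′ = absorbs′ , q′-not-dom
      where
      absorbs′ : ∀ {v} → Dominating _⇒_ c v → Adjacent _⇒_ v q′ → v ⇒ q′
      absorbs′ {v} v-dom v~q′ with adjacent? v q
      ... | yes v~q = orient v~q′ (no-triangle (absorbs v-dom v~q) q⇒q′)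
      ... | no v≁q  = orient v~q′ (no-triangle (v-dom j) cⱼ⇒q′)
        where
        q-dominated : Dominated _⇒_ c q
        q-dominated = dominated-if-not-dominating (non-neighbour-complete (inj₁ ∘ v-dom) v≁q) q-not-dom
        j : I
        j = proj₁ (adjacent-to-some q′)
        cⱼ⇒q′ : c j ⇒ q′
        cⱼ⇒q′ = orient (swap (proj₂ (adjacent-to-some q′))) (no-triangle (q-dominated j) q⇒q′)
      q′-not-dom : ¬ Dominating _⇒_ c q′
      q′-not-dom q′-dom with adjacent? q′ q
      ... | yes q′~q = asym q⇒q′ (absorbs q′-dom q′~q)
      ... | no q′≁q  = no-triangle (q-dominated i₀) q⇒q′ (q′-dom i₀)
        where
        q-dominated : Dominated _⇒_ c q
        q-dominated = dominated-if-not-dominating (non-neighbour-complete (inj₁ ∘ q′-dom) q′≁q) q-not-dom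

    downstream-star : ∀ {q q′} → Downstream q → Star _⇒_ q q′ → Downstream q′
    downstream-star d ε       = d
    downstream-star d (a ◅ p) = downstream-star (downstream-step d a) p

    reachable-not-dominating : ∀ {i q} → Star _⇒_ (c i) q → ¬ Dominating _⇒_ c q
    reachable-not-dominating {i} =
      proj₂ ∘ downstream-star ((λ v-dom _ → v-dom i) , λ cᵢ-dom → irrefl (cᵢ-dom i))

strongly-connected-not-complete :
  {_⇒_ : Rel V ℓ} → IsC3FreeMultipartiteTournament _⇒_ →
  ∀ {I : Set} {c : I → V} → Homogeneous _⇒_ c → ∀ {i₀ i₁} → c i₀ ⇒ c i₁ →
  ∀ {i j q} → Star _⇒_ (c i) q → Star _⇒_ q (c j) → ¬ Complete _⇒_ c q
strongly-connected-not-complete T homogeneous c₀⇒c₁ from to q-complete =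
  [ reachable-not-dominating T homogeneous c₀⇒c₁ from
  , reachable-not-dominating (reverse-C3Free T) (swap ∘ homogeneous ∘ (swap ∘_)) c₀⇒c₁ (reverse id to)
  ] (homogeneous q-complete)

Arc : (D : Digraph) → Rel (Fin (n D)) 0ℓ
Arc D x y = arc D x y ≡ true

arc? : (D : Digraph) → Decidable (Arc D)
arc? D x y = arc D x y Bool.≟ true

TwinFree : Digraph → Set
TwinFree H = ∀ i j → i ≢ j → ∃ λ k → arc H i k ≢ arc H j k ⊎ arc H k i ≢ arc H k j

twinFree? : (H : Digraph) → Dec (TwinFree H)
twinFree? H = all? λ i → all? λ j → ¬? (i ≟ j) →-dec any? λ k →
  ¬? (arc H i k Bool.≟ arc H j k) ⊎-dec ¬? (arc H k i Bool.≟ arc H k j)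

induced : (H : Digraph) {D : Digraph} → TwinFree H → (f : Fin (n H) → Fin (n D)) →
          (∀ i j → arc D (f i) (f j) ≡ arc H i j) → H ⊑ind D
induced H {D} twin-free f preserves = f , injective , preserves
  where
  open ≡-Reasoning
  injective : Injective _≡_ _≡_ f
  injective {i} {j} fᵢ≡fⱼ with i ≟ j
  ... | yes i≡j = i≡j
  ... | no i≢j with twin-free i j i≢j
  ... | k , inj₁ out≢ = contradiction (begin
    arc H i k       ≡⟨ preserves i k ⟨
    arc D (f i) (f k) ≡⟨ cong (λ x → arc D x (f k)) fᵢ≡fⱼ ⟩
    arc D (f j) (f k) ≡⟨ preserves j k ⟩
    arc H j k       ∎) out≢
  ... | k , inj₂ in≢ = contradiction (begin
    arc H k i       ≡⟨ preserves k i ⟨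
    arc D (f k) (f i) ≡⟨ cong (arc D (f k)) fᵢ≡fⱼ ⟩
    arc D (f k) (f j) ≡⟨ preserves k j ⟩
    arc H k j       ∎) in≢

module _ (D : Digraph) where

  non-adjacent⇒no-arc : ∀ {x y} → NonAdjacent (Arc D) x y → arc D x y ≡ false
  non-adjacent⇒no-arc x≁y = Bool.¬-not (x≁y ∘ inj₁)

  no-arcs⇒non-adjacent : ∀ {x y} → arc D x y ≡ false → arc D y x ≡ false → NonAdjacent (Arc D) x y
  no-arcs⇒non-adjacent xy≡false _ (inj₁ x⇒y) = Bool.not-¬ x⇒y xy≡false
  no-arcs⇒non-adjacent _ yx≡false (inj₂ y⇒x) = Bool.not-¬ y⇒x yx≡false

  digon-free⇒asym : ¬ digon ⊑ind D → Asymmetric (Arc D)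
  digon-free⇒asym no-digon {x} {y} x⇒y y⇒x =
    no-digon (induced digon {D} (from-yes (twinFree? digon)) (lookup (x ∷ y ∷ [])) preserves)
    where
    preserves : ∀ i j → arc D (lookup (x ∷ y ∷ []) i) (lookup (x ∷ y ∷ []) j) ≡ digonArc i j
    preserves 0F 0F = loopless D x
    preserves 0F 1F = x⇒y
    preserves 1F 0F = y⇒x
    preserves 1F 1F = loopless D y

  module _ (asym : Asymmetric (Arc D)) where

    arc⇒no-reverse-arc : ∀ {x y} → Arc D x y → arc D y x ≡ false
    arc⇒no-reverse-arc = Bool.¬-not ∘ asym

    C3-free⇒no-triangle : ¬ C3 ⊑ind D → ∀ {x y z} → Arc D x y → Arc D y z → ¬ Arc D z x
    C3-free⇒no-triangle no-C3 {x} {y} {z} x⇒y y⇒z z⇒x =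
      no-C3 (induced C3 {D} (from-yes (twinFree? C3)) (lookup (x ∷ y ∷ z ∷ [])) preserves)
      where
      preserves : ∀ i j → arc D (lookup (x ∷ y ∷ z ∷ []) i) (lookup (x ∷ y ∷ z ∷ []) j) ≡ c3Arc i j
      preserves 0F 0F = loopless D x
      preserves 0F 1F = x⇒y
      preserves 0F 2F = arc⇒no-reverse-arc z⇒x
      preserves 1F 0F = arc⇒no-reverse-arc x⇒y
      preserves 1F 1F = loopless D y
      preserves 1F 2F = y⇒z
      preserves 2F 0F = z⇒x
      preserves 2F 1F = arc⇒no-reverse-arc y⇒z
      preserves 2F 2F = loopless D z

    arc+non-neighbour⇒K2+K1 : ∀ {u v w} → Arc D u w → NonAdjacent (Arc D) u v →
                               NonAdjacent (Arc D) v w → K2+K1 ⊑ind D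
    arc+non-neighbour⇒K2+K1 {u} {v} {w} u⇒w u≁v v≁w =
      induced K2+K1 {D} (from-yes (twinFree? K2+K1)) (lookup (u ∷ w ∷ v ∷ [])) preserves
      where
      preserves : ∀ i j → arc D (lookup (u ∷ w ∷ v ∷ []) i) (lookup (u ∷ w ∷ v ∷ []) j) ≡ k2k1Arc i j
      preserves 0F 0F = loopless D u
      preserves 0F 1F = u⇒w
      preserves 0F 2F = non-adjacent⇒no-arc u≁v
      preserves 1F 0F = arc⇒no-reverse-arc u⇒w
      preserves 1F 1F = loopless D w
      preserves 1F 2F = non-adjacent⇒no-arc (v≁w ∘ swap)
      preserves 2F 0F = non-adjacent⇒no-arc (u≁v ∘ swap)
      preserves 2F 1F = non-adjacent⇒no-arc v≁w
      preserves 2F 2F = loopless D v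

    K2+K1-free⇒≁-trans : ¬ K2+K1 ⊑ind D → Transitive (NonAdjacent (Arc D))
    K2+K1-free⇒≁-trans no-K2+K1 x≁y y≁z (inj₁ x⇒z) = no-K2+K1 (arc+non-neighbour⇒K2+K1 x⇒z x≁y y≁z)
    K2+K1-free⇒≁-trans no-K2+K1 x≁y y≁z (inj₂ z⇒x) =
      no-K2+K1 (arc+non-neighbour⇒K2+K1 z⇒x (y≁z ∘ swap) (x≁y ∘ swap))

  forb⇒C3Free : InForb D → IsC3FreeMultipartiteTournament (Arc D)
  forb⇒C3Free (no-digon , no-C3 , no-K2+K1) = record
    { _⇒?_        = arc? D
    ; asym        = asym
    ; no-triangle = C3-free⇒no-triangle asym no-C3
    ; ≁-trans     = K2+K1-free⇒≁-trans asym no-K2+K1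
    }
    where
    asym : Asymmetric (Arc D)
    asym = digon-free⇒asym no-digon

  C3Free⇒forb : IsC3FreeMultipartiteTournament (Arc D) → InForb D
  C3Free⇒forb T =
      (λ (_ , _ , preserves) → asym (preserves 0F 1F) (preserves 1F 0F))
    , (λ (_ , _ , preserves) → no-triangle (preserves 0F 1F) (preserves 1F 2F) (preserves 2F 0F))
    , (λ (_ , _ , preserves) → ≁-trans (no-arcs⇒non-adjacent (preserves 0F 2F) (preserves 2F 0F))
                                       (no-arcs⇒non-adjacent (preserves 2F 1F) (preserves 1F 2F))
                                       (inj₁ (preserves 0F 1F)))
    where open IsC3FreeMultipartiteTournament T

indicator : {A : Set ℓ} → Dec A → Fin 2
indicator (yes _) = 1F
indicator (no _)  = 0F

indicator-reflects : {A B : Set ℓ} (a? : Dec A) (b? : Dec B) → indicator a? ≡ indicator b? → A → B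
indicator-reflects _       (yes b) _  _ = b
indicator-reflects (no ¬a) (no _)  _  a = contradiction a ¬a

module Colouring {D : Digraph} (T : IsC3FreeMultipartiteTournament (Arc D)) where
  open IsC3FreeMultipartiteTournament T

  _⇄_ : Rel (Fin (n D)) 0ℓ
  x ⇄ y = Star (Arc D) x y × Star (Arc D) y x

  ⇄-trans : Transitive _⇄_
  ⇄-trans (x⇒*y , y⇒*x) (y⇒*z , z⇒*y) = x⇒*y ◅◅ y⇒*z , z⇒*y ◅◅ y⇒*x

  _⇄?_ : Decidable _⇄_
  x ⇄? y = star? _⇒?_ x y ×-dec star? _⇒?_ y x

  least-in-component : ∀ v → ∃ (Least (_⇄ v))
  least-in-component v = least (_⇄? v) (v , ε , ε)

  representative : Fin (n D) → Fin (n D)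
  representative v = proj₁ (least-in-component v)

  representative-cong : ∀ {u v} → u ⇄ v → representative u ≡ representative v
  representative-cong (u⇒*v , v⇒*u) =
    least-unique ((λ w⇄u → ⇄-trans w⇄u (u⇒*v , v⇒*u)) , (λ w⇄v → ⇄-trans w⇄v (v⇒*u , u⇒*v)))
                 (proj₂ (least-in-component _)) (proj₂ (least-in-component _))

  colour : Fin (n D) → Fin 2
  colour v = indicator (adjacent? v (representative v))

  colour-dicolouring : IsDicolouring D 2 colour
  colour-dicolouring C monochromatic = contradict (adjacent? (c 0F) r)
    where
    c : Fin (suc (suc (m C))) → Fin (n D)
    c = vtx C
    r : Fin (n D)
    r = representative (c 0F)
    on-cycle : ∀ i → c i ⇄ c 0F
    on-cycle i = cycle-to-start (step C) (close C) i , cycle-from-start (step C) (close C) i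
    colour-via-r : ∀ i → colour (c i) ≡ indicator (adjacent? (c i) r)
    colour-via-r i = cong (indicator ∘ adjacent? (c i)) (representative-cong (on-cycle i))
    same-adjacency : ∀ i j → Adjacent (Arc D) (c i) r → Adjacent (Arc D) (c j) r
    same-adjacency i j = indicator-reflects (adjacent? (c i) r) (adjacent? (c j) r) (begin
      indicator (adjacent? (c i) r) ≡⟨ colour-via-r i ⟨
      colour (c i)                  ≡⟨ monochromatic i ⟩
      colour (c 0F)                 ≡⟨ monochromatic j ⟨
      colour (c j)                  ≡⟨ colour-via-r j ⟩
      indicator (adjacent? (c j) r) ∎)
      where open ≡-Reasoning
    r⇄c₀ : r ⇄ c 0F
    r⇄c₀ = proj₁ (proj₂ (least-in-component (c 0F)))
    contradict : Dec (Adjacent (Arc D) (c 0F) r) → ⊥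
    contradict (yes c₀~r) =
      strongly-connected-not-complete T (cycle-homogeneous T (step C) (close C)) (step C 0F)
        (proj₂ r⇄c₀) (proj₁ r⇄c₀) (λ i → swap (same-adjacency 0F i c₀~r))
    contradict (no c₀≁r) = ≁-trans c₀≁r (c₀≁r ∘ same-adjacency 1F 0F ∘ swap) (inj₁ (step C 0F))

  dicolourable : Dicolourable D 2
  dicolourable = colour , colour-dicolouring

c4Arc : Fin 4 → Fin 4 → Bool
c4Arc 0F 1F = true
c4Arc 1F 2F = true
c4Arc 2F 3F = true
c4Arc 3F 0F = true
c4Arc _  _  = false

C4 : Digraph
C4 = record { n = 4 ; arc = c4Arc ; loopless = λ { 0F → refl ; 1F → refl ; 2F → refl ; 3F → refl } }

C4-C3Free : IsC3FreeMultipartiteTournament (Arc C4)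
C4-C3Free = record
  { _⇒?_        = arc? C4
  ; asym        = λ {x} {y} → from-yes asym? x y
  ; no-triangle = λ {x} {y} {z} → from-yes no-triangle? x y z
  ; ≁-trans     = λ {x} {y} {z} → from-yes ≁-trans? x y z
  }
  where
  _⇒_ : Rel (Fin 4) 0ℓ
  _⇒_ = Arc C4
  _⇒?_ : Decidable _⇒_
  _⇒?_ = arc? C4
  asym? : Dec (∀ x y → x ⇒ y → ¬ y ⇒ x)
  asym? = all? λ x → all? λ y → x ⇒? y →-dec ¬? (y ⇒? x)
  no-triangle? : Dec (∀ x y z → x ⇒ y → y ⇒ z → ¬ z ⇒ x)
  no-triangle? = all? λ x → all? λ y → all? λ z → x ⇒? y →-dec y ⇒? z →-dec ¬? (z ⇒? x)
  ≁? : Decidable (NonAdjacent _⇒_)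
  ≁? x y = ¬? (x ⇒? y ⊎-dec y ⇒? x)
  ≁-trans? : Dec (∀ x y z → NonAdjacent _⇒_ x y → NonAdjacent _⇒_ y z → NonAdjacent _⇒_ x z)
  ≁-trans? = all? λ x → all? λ y → all? λ z → ≁? x y →-dec ≁? y z →-dec ≁? x z

C4-cycle : DirectedCycle C4
C4-cycle = record { m = 2 ; vtx = id ; inj = id ; step = λ { 0F → refl ; 1F → refl ; 2F → refl } ; close = refl }

C4-not-dicolourable-1 : ¬ Dicolourable C4 1
C4-not-dicolourable-1 (colour , acyclic) = acyclic C4-cycle λ i → one-colour (colour i) (colour 0F)
  where
  one-colour : (x y : Fin 1) → x ≡ y
  one-colour 0F 0F = refl

theorem9 : ((D : Digraph) → InForb D → Dicolourable D 2)
           × Σ Digraph (λ D → InForb D × ¬ Dicolourable D 1)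
theorem9 = (λ D D∈Forb → Colouring.dicolourable (forb⇒C3Free D D∈Forb))
         , C4 , C3Free⇒forb C4 C4-C3Free , C4-not-dicolourable-1
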